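{- In $\mathsf{2CH}$, for every agent $a$ and every atomic proposition $p_a\in AP_a$, $\vdash_a\Box_a\langle a\rangle p_a\vee\Box_a\langle a\rangle\neg p_a$.
   Context: Syntax. Fix a finite set $\mathcal{A}$ of agents, sets $AP_a$ ($a\in\mathcal A$) and $AP_e$ of atomic propositions. Agent formulas of sort $a$: $\varphi ::= p_a \mid \neg\varphi \mid \varphi\wedge\psi \mid \Diamond_a\Phi$ ($p_a\in AP_a$, $\Phi$ a world formula). World formulas: $\Phi ::= p_e \mid \neg\Phi \mid \Phi\wedge\Psi \mid \langle a\rangle\varphi$ ($p_e\in AP_e$, $\varphi$ of sort $a$). Abbreviations: usual $\top,\bot,\vee,\to$; $\Box_a\Phi:=\neg\Diamond_a\neg\Phi$; $[a]\varphi:=\neg\langle a\rangle\neg\varphi$. Proof system. $\vdash_a$, $\vdash_e$ are the least relations containing all propositional tautology instances at each sort, closed under modus ponens at each sort, and under: from $\vdash_e\Phi$ infer $\vdash_a\Box_a\Phi$; from $\vdash_a\varphi$ infer $\vdash_e[a]\varphi$; from $\vdash_e\Phi\to\Psi$ infer $\vdash_a\Diamond_a\Phi\to\Diamond_a\Psi$ and $\vdash_a\Box_a\Phi\to\Box_a\Psi$; from $\vdash_a\varphi\to\psi$ infer $\vdash_e\langle a\rangle\varphi\to\langle a\rangle\psi$ and $\vdash_e[a]\varphi\to[a]\psi$; $\vdash_e\Phi\to[a]\psi$ iff $\vdash_a\Diamond_a\Phi\to\psi$; $\vdash_a\varphi\to\Box_a\Psi$ iff $\vdash_e\langle a\rangle\varphi\to\Psi$;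 axioms $\vdash_a\varphi\to\Diamond_a\langle a\rangle\varphi$, $\vdash_a\Diamond_a\langle a\rangle\varphi\to\varphi$, $\vdash_e\bigvee_{a\in\mathcal A}\langle a\rangle\top$. -}

module Defs where

open import Data.Nat using (ℕ)
open import Data.Fin using (Fin)
open import Data.List using (List; []; _∷_; allFin)
open import Data.Bool using (Bool; true; false; not; _∧_)
open import Relation.Binary.PropositionalEquality using (_≡_)

-- Agents: a finite set 𝒜, represented as Fin n.
-- APa a : atomic propositions of agent a;  APe : atomic world propositions.
module Logic (n : ℕ) (APa : Fin n → Set) (APe : Set) where

  Agent : Set
  Agent = Fin n

  infixr 6 _∧ₐ_ _∧ₑ_
  infix 7 ¬ₐ_ ¬ₑ_
  infixr 5 _∨ₐ_ _∨ₑ_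
  infixr 4 _⇒ₐ_ _⇒ₑ_
  infix 8 ⟨_⟩_ [_]_

  mutual
    data AForm (a : Agent) : Set where
      ⊤ₐ    : AForm a
      patom : APa a → AForm a
      ¬ₐ_   : AForm a → AForm a
      _∧ₐ_  : AForm a → AForm a → AForm a
      ◇     : WForm → AForm a

    data WForm : Set where
      ⊤ₑ     : WForm
      patomₑ : APe → WForm
      ¬ₑ_    : WForm → WForm
      _∧ₑ_   : WForm → WForm → WForm
      ⟨_⟩_   : (a : Agent) → AForm a → WForm

  ⊥ₐ : ∀ {a} → AForm a
  ⊥ₐ = ¬ₐ ⊤ₐ

  ⊥ₑ : WForm
  ⊥ₑ = ¬ₑ ⊤ₑ

  _∨ₐ_ : ∀ {a} → AForm a → AForm a → AForm a
  φ ∨ₐ ψ = ¬ₐ (¬ₐ φ ∧ₐ ¬ₐ ψ)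

  _⇒ₐ_ : ∀ {a} → AForm a → AForm a → AForm a
  φ ⇒ₐ ψ = ¬ₐ (φ ∧ₐ ¬ₐ ψ)

  _∨ₑ_ : WForm → WForm → WForm
  Φ ∨ₑ Ψ = ¬ₑ (¬ₑ Φ ∧ₑ ¬ₑ Ψ)

  _⇒ₑ_ : WForm → WForm → WForm
  Φ ⇒ₑ Ψ = ¬ₑ (Φ ∧ₑ ¬ₑ Ψ)

  □ : ∀ {a} → WForm → AForm a
  □ Φ = ¬ₐ ◇ (¬ₑ Φ)

  [_]_ : (a : Agent) → AForm a → WForm
  [ a ] φ = ¬ₑ (⟨ a ⟩ (¬ₐ φ))

  ⋁ₑ : List WForm → WForm
  ⋁ₑ []       = ⊥ₑ
  ⋁ₑ (Φ ∷ Φs) = Φ ∨ₑ ⋁ₑ Φs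

  someAgentActs : WForm
  someAgentActs = ⋁ₑ (Data.List.map (λ a → ⟨ a ⟩ ⊤ₐ) (allFin n))

  -- Propositional tautology instances: true under every Boolean valuation of
  -- the maximal non-Boolean subformulas (atoms and modal formulas), with the
  -- Boolean connectives ⊤, ¬, ∧ evaluated compositionally.
  evalA : ∀ {a} → (AForm a → Bool) → AForm a → Bool
  evalA v ⊤ₐ       = true
  evalA v (¬ₐ φ)   = not (evalA v φ)
  evalA v (φ ∧ₐ ψ) = evalA v φ ∧ evalA v ψ
  evalA v (patom p) = v (patom p)
  evalA v (◇ Φ)     = v (◇ Φ)

  evalE : (WForm → Bool) → WForm → Bool
  evalE v ⊤ₑ       = true
  evalE v (¬ₑ Φ)   = not (evalE v Φ)
  evalE v (Φ ∧ₑ Ψ) = evalE v Φ ∧ evalE v Ψ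
  evalE v (patomₑ p) = v (patomₑ p)
  evalE v (⟨ a ⟩ φ)  = v (⟨ a ⟩ φ)

  TautA : ∀ {a} → AForm a → Set
  TautA φ = ∀ v → evalA v φ ≡ true

  TautE : WForm → Set
  TautE Φ = ∀ v → evalE v Φ ≡ true

  mutual
    data ⊢a : (a : Agent) → AForm a → Set where
      tautA   : ∀ {a} {φ : AForm a} → TautA φ → ⊢a a φ
      mpA     : ∀ {a} {φ ψ : AForm a} → ⊢a a (φ ⇒ₐ ψ) → ⊢a a φ → ⊢a a ψ
      necA    : ∀ {a} {Φ} → ⊢e Φ → ⊢a a (□ Φ)
      mono◇   : ∀ {a} {Φ Ψ} → ⊢e (Φ ⇒ₑ Ψ) → ⊢a a (◇ Φ ⇒ₐ ◇ Ψ)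
      mono□   : ∀ {a} {Φ Ψ} → ⊢e (Φ ⇒ₑ Ψ) → ⊢a a (□ Φ ⇒ₐ □ Ψ)
      adj1A   : ∀ {a} {Φ} {ψ : AForm a} → ⊢e (Φ ⇒ₑ [ a ] ψ) → ⊢a a (◇ Φ ⇒ₐ ψ)
      adj2A   : ∀ {a} {φ : AForm a} {Ψ} → ⊢e ((⟨ a ⟩ φ) ⇒ₑ Ψ) → ⊢a a (φ ⇒ₐ □ Ψ)
      axUnit  : ∀ {a} {φ : AForm a} → ⊢a a (φ ⇒ₐ ◇ (⟨ a ⟩ φ))
      axCounit : ∀ {a} {φ : AForm a} → ⊢a a (◇ (⟨ a ⟩ φ) ⇒ₐ φ)

    data ⊢e : WForm → Set where
      tautE   : ∀ {Φ} → TautE Φ → ⊢e Φ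
      mpE     : ∀ {Φ Ψ} → ⊢e (Φ ⇒ₑ Ψ) → ⊢e Φ → ⊢e Ψ
      necE    : ∀ {a} {φ : AForm a} → ⊢a a φ → ⊢e ([ a ] φ)
      mono⟨⟩  : ∀ {a} {φ ψ : AForm a} → ⊢a a (φ ⇒ₐ ψ) → ⊢e ((⟨ a ⟩ φ) ⇒ₑ (⟨ a ⟩ ψ))
      mono[]  : ∀ {a} {φ ψ : AForm a} → ⊢a a (φ ⇒ₐ ψ) → ⊢e (([ a ] φ) ⇒ₑ ([ a ] ψ))
      adj1E   : ∀ {a} {Φ} {ψ : AForm a} → ⊢a a (◇ Φ ⇒ₐ ψ) → ⊢e (Φ ⇒ₑ [ a ] ψ)
      adj2E   : ∀ {a} {φ : AForm a} {Ψ} → ⊢a a (φ ⇒ₐ □ Ψ) → ⊢e ((⟨ a ⟩ φ) ⇒ₑ Ψ)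
      axSome  : ⊢e someAgentActs

{-# OPTIONS --safe #-}
-- Since ⟨a⟩ is left adjoint to □ (rule adj2A), the unit gives ⊢ φ → □⟨a⟩φ for every
-- agent formula φ; applying it to φ and to ¬φ and splitting on φ yields the disjunction.
module Submission where

open import Defs
open import Data.Nat using (ℕ)
open import Data.Fin using (Fin)
open import Data.Bool using (true; false)
open import Relation.Binary.PropositionalEquality using (refl)

module Derivations (n : ℕ) (APa : Fin n → Set) (APe : Set) where
  open Logic n APa APe

  ⇒ₑ-refl : (Φ : WForm) → ⊢e (Φ ⇒ₑ Φ)
  ⇒ₑ-refl Φ = tautE tautology
    where
    tautology : TautE (Φ ⇒ₑ Φ)
    tautology v with evalE v Φ
    ... | true  = refl
    ... | false = refl

  ⇒-□⟨⟩ : ∀ {a} (φ : AForm a) → ⊢a a (φ ⇒ₐ □ (⟨ a ⟩ φ))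
  ⇒-□⟨⟩ {a} φ = adj2A (⇒ₑ-refl (⟨ a ⟩ φ))

  ∨ₐ-cases : ∀ {a} {φ ψ χ : AForm a} →
             ⊢a a (φ ⇒ₐ ψ) → ⊢a a (¬ₐ φ ⇒ₐ χ) → ⊢a a (ψ ∨ₐ χ)
  ∨ₐ-cases {a} {φ} {ψ} {χ} φ⇒ψ ¬φ⇒χ = mpA (mpA (tautA tautology) φ⇒ψ) ¬φ⇒χ
    where
    tautology : TautA ((φ ⇒ₐ ψ) ⇒ₐ (¬ₐ φ ⇒ₐ χ) ⇒ₐ ψ ∨ₐ χ)
    tautology v with evalA v φ | evalA v ψ | evalA v χ
    ... | true  | true  | true  = refl
    ... | true  | true  | false = refl
    ... | true  | false | true  = refl
    ... | true  | false | false = refl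
    ... | false | true  | true  = refl
    ... | false | true  | false = refl
    ... | false | false | true  = refl
    ... | false | false | false = refl

  □⟨⟩-excluded-middle : ∀ {a} (φ : AForm a) → ⊢a a (□ (⟨ a ⟩ φ) ∨ₐ □ (⟨ a ⟩ (¬ₐ φ)))
  □⟨⟩-excluded-middle φ = ∨ₐ-cases (⇒-□⟨⟩ φ) (⇒-□⟨⟩ (¬ₐ φ))

mainTheorem7 : (n : ℕ) (APa : Fin n → Set) (APe : Set) → let open Logic n APa APe in (a : Agent) (p : APa a) → ⊢a a (□ (⟨ a ⟩ patom p) ∨ₐ □ (⟨ a ⟩ (¬ₐ patom p)))
mainTheorem7 n APa APe a p = □⟨⟩-excluded-middle (patom p)
  where
  open Logic n APa APe using (patom)
  open Derivations n APa APe
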